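{- Let $\mathrm{A},\mathrm{B}$ be disjoint finite sets of modalities, $L_1$ an $\mathrm{A}$-logic containing $\Box_{\mathrm{A}}^m\bot$ for some $m<\omega$, and $L_2$ a locally tabular $\mathrm{B}$-logic. Then $L_1\times L_2$ is locally tabular.
   Context: An $\mathrm{A}$-logic is a normal modal logic with diamonds from $\mathrm{A}$. $\lozenge_{\mathrm{A}}\varphi=\bigvee_{\lozenge\in\mathrm{A}}\lozenge\varphi$, $\Box_{\mathrm{A}}\varphi=\neg\lozenge_{\mathrm{A}}\neg\varphi$, and $\Box_{\mathrm{A}}^m$ is its $m$-fold iteration. For an $\mathrm{A}$-frame $F$ and a $\mathrm{B}$-frame $G$ on $X$, $Y$, $F\times G$ is the frame on $X\times Y$ where each $\lozenge\in\mathrm{A}$ acts on the first coordinate with the second fixed and each $\lozenge\in\mathrm{B}$ acts on the second coordinate with the first fixed; $L_1\times L_2$ is the set of formulas valid in all $F\times G$ with $F\models L_1$, $G\models L_2$. A logic is locally tabular if for each finite $k$ it has only finitely many pairwise nonequivalent formulas in $k$ variables. -}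

module Defs where

open import Level using (Level; _⊔_) renaming (suc to lsuc; zero to lzero)
open import Data.Nat using (ℕ; zero; suc)
open import Data.Fin using (Fin; toℕ)
open import Data.List using (List; []; _∷_; foldr)
open import Data.List.Relation.Unary.Any using (Any)
open import Data.Product using (Σ; ∃; _×_; _,_)
open import Data.Sum using (_⊎_; inj₁; inj₂)
open import Data.Empty using (⊥)
open import Relation.Nullary using (¬_)
open import Relation.Binary.PropositionalEquality using (_≡_)
open import Data.Fin.Base using () renaming (toℕ to finToℕ)
open import Data.List.Base using () renaming (map to lmap)
open import Data.Vec.Functional using ()
import Data.List as L

data Form (I V : Set) : Set where
  var : V → Form I V
  ⊥f  : Form I V
  _⇒_ : Form I V → Form I V → Form I V
  ◇   : I → Form I V → Form I V

infixr 5 _⇒_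

module _ {I V : Set} where
  ¬f : Form I V → Form I V
  ¬f φ = φ ⇒ ⊥f

  ⊤f : Form I V
  ⊤f = ⊥f ⇒ ⊥f

  _∨f_ : Form I V → Form I V → Form I V
  φ ∨f ψ = ¬f φ ⇒ ψ

  _∧f_ : Form I V → Form I V → Form I V
  φ ∧f ψ = ¬f (φ ⇒ ¬f ψ)

  _⇔_ : Form I V → Form I V → Form I V
  φ ⇔ ψ = (φ ⇒ ψ) ∧f (ψ ⇒ φ)

  □ : I → Form I V → Form I V
  □ i φ = ¬f (◇ i (¬f φ))

rename : {I V W : Set} → (V → W) → Form I V → Form I W
rename f (var x) = var (f x)
rename f ⊥f      = ⊥f
rename f (φ ⇒ ψ) = rename f φ ⇒ rename f ψ
rename f (◇ i φ) = ◇ i (rename f φ)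

subst : {I V W : Set} → (V → Form I W) → Form I V → Form I W
subst σ (var x) = σ x
subst σ ⊥f      = ⊥f
subst σ (φ ⇒ ψ) = subst σ φ ⇒ subst σ ψ
subst σ (◇ i φ) = ◇ i (subst σ φ)

Fm : Set → Set
Fm I = Form I ℕ

◇A : {a : ℕ} {V : Set} → Form (Fin a) V → Form (Fin a) V
◇A {a} φ = foldr (λ i ψ → ◇ i φ ∨f ψ) ⊥f (L.allFin a)

□A : {a : ℕ} {V : Set} → Form (Fin a) V → Form (Fin a) V
□A φ = ¬f (◇A (¬f φ))

□A^ : {a : ℕ} {V : Set} → ℕ → Form (Fin a) V → Form (Fin a) V
□A^ zero    φ = φ
□A^ (suc m) φ = □A (□A^ m φ)

record IsNormalLogic {ℓ : Level} {I : Set} (L : Fm I → Set ℓ) : Set ℓ where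
  field
    -- classical propositional axioms (complete for {→, ⊥})
    ax1  : ∀ φ ψ → L (φ ⇒ ψ ⇒ φ)
    ax2  : ∀ φ ψ χ → L ((φ ⇒ ψ ⇒ χ) ⇒ (φ ⇒ ψ) ⇒ φ ⇒ χ)
    ax3  : ∀ φ → L (¬f (¬f φ) ⇒ φ)
    axK  : ∀ i φ ψ → L (□ i (φ ⇒ ψ) ⇒ □ i φ ⇒ □ i ψ)
    mp   : ∀ {φ ψ} → L (φ ⇒ ψ) → L φ → L ψ
    nec  : ∀ i {φ} → L φ → L (□ i φ)
    sub  : ∀ (σ : ℕ → Fm I) {φ} → L φ → L (subst σ φ)

-- Local tabularity: for each k, finitely many L-nonequivalent formulas in
-- the variables p₀..p_{k-1}; i.e. a finite list of representatives such
-- that every k-variable formula is L-equivalent to one of them.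

embed : {I : Set} {k : ℕ} → Form I (Fin k) → Fm I
embed = rename toℕ

LocallyTabular : {ℓ : Level} {I : Set} → (Fm I → Set ℓ) → Set ℓ
LocallyTabular {I = I} L =
  ∀ (k : ℕ) → Σ (List (Form I (Fin k))) λ reps →
    ∀ (φ : Form I (Fin k)) → Any (λ ψ → L (embed φ ⇔ embed ψ)) reps

record Frame (I : Set) : Set₁ where
  field
    W : Set
    R : I → W → W → Set

open Frame public

-- Truth values are ¬¬-stable so that the semantics is the classical one
-- (Gödel–Gentzen reading): x ⊨ p iff ¬¬ (x ∈ V p); x ⊨ ◇ᵢ φ iff ¬¬ ∃ y (x Rᵢ y ∧ y ⊨ φ).
Sat : {I : Set} (F : Frame I) → (ℕ → W F → Set) → W F → Fm I → Set
Sat F Val x (var p) = ¬ ¬ Val p x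
Sat F Val x ⊥f      = ⊥
Sat F Val x (φ ⇒ ψ) = Sat F Val x φ → Sat F Val x ψ
Sat F Val x (◇ i φ) = ¬ ¬ (Σ (W F) λ y → R F i x y × Sat F Val y φ)

_⊨_ : {I : Set} → Frame I → Fm I → Set₁
F ⊨ φ = ∀ (Val : ℕ → W F → Set) (x : W F) → Sat F Val x φ

_⊨L_ : {ℓ : Level} {I : Set} → Frame I → (Fm I → Set ℓ) → Set (lsuc lzero ⊔ ℓ)
F ⊨L L = ∀ φ → L φ → F ⊨ φ

_×F_ : {A B : Set} → Frame A → Frame B → Frame (A ⊎ B)
W (F ×F G) = W F × W G
R (F ×F G) (inj₁ i) (x , y) (x' , y') = R F i x x' × (y ≡ y')
R (F ×F G) (inj₂ j) (x , y) (x' , y') = (x ≡ x') × R G j y y'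

_⊗_ : {A B : Set} → (Fm A → Set) → (Fm B → Set) → Fm (A ⊎ B) → Set₁
(L₁ ⊗ L₂) φ = ∀ (F : Frame _) (G : Frame _) → F ⊨L L₁ → G ⊨L L₂ → (F ×F G) ⊨ φ

-- Let L₂ be locally tabular and L₁ ∋ □_A^m ⊥, so every point x of an L₁-frame F has
-- A-depth < m.  We show, by induction on d, that k-variable (A ∪ B)-formulas fall into
-- finitely many classes of equivalence at points (x, y) of F × G with x of depth < d and
-- G ⊨ L₂.  For the step, replace each outermost ◇ᵢψ (i ∈ A) by a fresh variable naming i
-- and the class of ψ at depth < d: what remains is a B-formula in finitely many
-- variables, which has only finitely many classes modulo L₂; substituting the ◇ᵢψ back
-- yields a finite set of representatives at depth < d + 1, because a B-formula is
-- evaluated along the fibre {x} × G, and the successors of x along A have depth < d.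
module Submission where

open import Defs renaming (_⇔_ to _⇔ᶠ_)
open import Level using (Level; _⊔_)
open import Data.Nat using (ℕ; zero; suc)
open import Data.Fin using (Fin; toℕ)
open import Data.Fin.Properties using (toℕ-injective; +↔⊎; *↔×)
open import Data.List as List using (List; []; _∷_; length; foldr; allFin)
open import Data.List.Relation.Unary.Any as Any using (Any; here; there; index)
open import Data.List.Relation.Unary.Any.Properties using (map⁺; lookup-result)
open import Data.List.Membership.Propositional using (_∈_)
open import Data.List.Membership.Propositional.Properties using (∈-allFin)
open import Data.Product using (∃; Σ; _×_; _,_; proj₁; proj₂)
open import Data.Sum using (_⊎_; inj₁; inj₂; [_,_])
open import Data.Sum.Function.Propositional using (_⊎-↔_)
open import Data.Empty using (⊥; ⊥-elim)
open import Function using (id)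
open import Function.Bundles using (_⇔_; mk⇔; Equivalence; _↔_; Inverse)
import Function.Properties.Equivalence as ⇔
open import Function.Properties.Inverse using (↔-refl; ↔-sym; ↔-trans)
open import Function.Related.TypeIsomorphisms using (→-cong-⇔)
open import Relation.Nullary using (¬_)
open import Relation.Nullary.Negation using (¬¬-map; negated-stable; Stable)
open import Relation.Binary.PropositionalEquality as ≡ using (_≡_; refl)

open Equivalence using (to; from)

¬¬-cong : {A B : Set} → A ⇔ B → (¬ ¬ A) ⇔ (¬ ¬ B)
¬¬-cong A⇔B = mk⇔ (¬¬-map (to A⇔B)) (¬¬-map (from A⇔B))

◇-cong : {X : Set} {R P Q : X → Set} → (∀ y → P y ⇔ Q y)
  → (¬ ¬ Σ X λ y → R y × P y) ⇔ (¬ ¬ Σ X λ y → R y × Q y)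
◇-cong P⇔Q = ¬¬-cong (mk⇔ (λ (y , r , p) → y , r , to (P⇔Q y) p)
                          (λ (y , r , q) → y , r , from (P⇔Q y) q))

FiniteUpTo : {a ℓ : Level} {A : Set a} → (A → A → Set ℓ) → Set (a ⊔ ℓ)
FiniteUpTo {A = A} _≈_ = Σ (List A) λ reps → ∀ x → Any (x ≈_) reps

FiniteUpTo-map : {a ℓ ℓ′ : Level} {A : Set a} {_≈_ : A → A → Set ℓ} {_≈′_ : A → A → Set ℓ′}
  → (∀ {x y} → x ≈ y → x ≈′ y) → FiniteUpTo _≈_ → FiniteUpTo _≈′_
FiniteUpTo-map ≈⇒≈′ (reps , cover) = reps , λ x → Any.map ≈⇒≈′ (cover x)

rename◇ : {I J V : Set} → (I → J) → Form I V → Form J V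
rename◇ f (var v) = var v
rename◇ f ⊥f      = ⊥f
rename◇ f (φ ⇒ ψ) = rename◇ f φ ⇒ rename◇ f ψ
rename◇ f (◇ i φ) = ◇ (f i) (rename◇ f φ)

SatV : {I V : Set} (F : Frame I) → (V → W F → Set) → W F → Form I V → Set
SatV F U x (var p) = ¬ ¬ U p x
SatV F U x ⊥f      = ⊥
SatV F U x (φ ⇒ ψ) = SatV F U x φ → SatV F U x ψ
SatV F U x (◇ i φ) = ¬ ¬ (Σ (W F) λ y → R F i x y × SatV F U y φ)

SatV-stable : {I V : Set} (F : Frame I) (U : V → W F → Set) (x : W F) (φ : Form I V)
  → Stable (SatV F U x φ)
SatV-stable F U x (var p) = negated-stable
SatV-stable F U x ⊥f      = λ ¬¬⊥ → ¬¬⊥ id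
SatV-stable F U x (φ ⇒ ψ) = λ ¬¬φ⇒ψ s → SatV-stable F U x ψ (¬¬-map (λ f → f s) ¬¬φ⇒ψ)
SatV-stable F U x (◇ i φ) = negated-stable

Sat⇔SatV : {I : Set} (F : Frame I) (Val : ℕ → W F → Set) (x : W F) (φ : Fm I)
  → Sat F Val x φ ⇔ SatV F Val x φ
Sat⇔SatV F Val x (var p) = ⇔.refl
Sat⇔SatV F Val x ⊥f      = ⇔.refl
Sat⇔SatV F Val x (φ ⇒ ψ) = →-cong-⇔ (Sat⇔SatV F Val x φ) (Sat⇔SatV F Val x ψ)
Sat⇔SatV F Val x (◇ i φ) = ◇-cong λ y → Sat⇔SatV F Val y φ

SatV-rename : {I V V′ : Set} (F : Frame I) {U : V → W F → Set} {U′ : V′ → W F → Set}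
  (f : V → V′) → (∀ v w → U′ (f v) w ⇔ U v w)
  → ∀ x (φ : Form I V) → SatV F U′ x (rename f φ) ⇔ SatV F U x φ
SatV-rename F f U∘f x (var p) = ¬¬-cong (U∘f p x)
SatV-rename F f U∘f x ⊥f      = ⇔.refl
SatV-rename F f U∘f x (φ ⇒ ψ) = →-cong-⇔ (SatV-rename F f U∘f x φ) (SatV-rename F f U∘f x ψ)
SatV-rename F f U∘f x (◇ i φ) = ◇-cong λ y → SatV-rename F f U∘f y φ

SatV-subst : {I V V′ : Set} (F : Frame I) (U : V′ → W F → Set) (σ : V → Form I V′)
  → ∀ x (φ : Form I V) → SatV F U x (subst σ φ) ⇔ SatV F (λ v w → SatV F U w (σ v)) x φ
SatV-subst F U σ x (var p) = mk⇔ (λ s ¬s → ¬s s) (SatV-stable F U x (σ p))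
SatV-subst F U σ x ⊥f      = ⇔.refl
SatV-subst F U σ x (φ ⇒ ψ) = →-cong-⇔ (SatV-subst F U σ x φ) (SatV-subst F U σ x ψ)
SatV-subst F U σ x (◇ i φ) = ◇-cong λ y → SatV-subst F U σ y φ

SatV-⇔ᶠ-elim : {I V : Set} (F : Frame I) (U : V → W F → Set) (x : W F) (φ ψ : Form I V)
  → SatV F U x (φ ⇔ᶠ ψ) → SatV F U x φ ⇔ SatV F U x ψ
SatV-⇔ᶠ-elim F U x φ ψ s = mk⇔
  (λ sφ → SatV-stable F U x ψ λ ¬sψ → s λ φ⇒ψ _ → ¬sψ (φ⇒ψ sφ))
  (λ sψ → SatV-stable F U x φ λ ¬sφ → s λ _ ψ⇒φ → ¬sφ (ψ⇒φ sψ))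

SatV-⇔ᶠ-intro : {I V : Set} (F : Frame I) (U : V → W F → Set) (x : W F) (φ ψ : Form I V)
  → SatV F U x φ ⇔ SatV F U x ψ → SatV F U x (φ ⇔ᶠ ψ)
SatV-⇔ᶠ-intro F U x φ ψ φ⇔ψ s = s (to φ⇔ψ) (from φ⇔ψ)

SatV-×F-fibre : {A B V : Set} (F : Frame A) (G : Frame B) (U : V → W F × W G → Set)
  → ∀ x y (χ : Form B V)
  → SatV (F ×F G) U (x , y) (rename◇ inj₂ χ) ⇔ SatV G (λ v y′ → U v (x , y′)) y χ
SatV-×F-fibre F G U x y (var v) = ⇔.refl
SatV-×F-fibre F G U x y ⊥f      = ⇔.refl
SatV-×F-fibre F G U x y (φ ⇒ ψ) =
  →-cong-⇔ (SatV-×F-fibre F G U x y φ) (SatV-×F-fibre F G U x y ψ)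
SatV-×F-fibre F G U x y (◇ j χ) = mk⇔
  (¬¬-map λ { ((x , y′) , (refl , r) , s) → y′ , r , to (SatV-×F-fibre F G U x y′ χ) s })
  (¬¬-map λ { (y′ , r , s) → (x , y′) , (refl , r) , from (SatV-×F-fibre F G U x y′ χ) s })

FrameEquivalent : {I V : Set} → (Fm I → Set) → Form I V → Form I V → Set₁
FrameEquivalent {I} {V} L φ ψ =
  ∀ (G : Frame I) → G ⊨L L → ∀ (U : V → W G → Set) y → SatV G U y φ ⇔ SatV G U y ψ

⇔ᶠ∈L⇒FrameEquivalent : {I : Set} {L : Fm I → Set} {K : ℕ} (φ ψ : Form I (Fin K))
  → L (embed φ ⇔ᶠ embed ψ) → FrameEquivalent L φ ψ
⇔ᶠ∈L⇒FrameEquivalent {K = K} φ ψ φ⇔ψ∈L G G⊨L U y =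
  ⇔.trans (⇔.sym (SatV-rename G toℕ Val∘toℕ⇔U y φ))
    (⇔.trans (SatV-⇔ᶠ-elim G Val y (embed φ) (embed ψ)
               (to (Sat⇔SatV G Val y (embed φ ⇔ᶠ embed ψ)) (G⊨L _ φ⇔ψ∈L Val y)))
      (SatV-rename G toℕ Val∘toℕ⇔U y ψ))
  where
    Val : ℕ → W G → Set
    Val n w = Σ (Fin K) λ v → toℕ v ≡ n × U v w

    Val∘toℕ⇔U : ∀ v w → Val (toℕ v) w ⇔ U v w
    Val∘toℕ⇔U v w = mk⇔ (λ (v′ , eq , u) → ≡.subst (λ v″ → U v″ w) (toℕ-injective eq) u)
                        (λ u → v , refl , u)

LocallyTabular⇒finite : {I V : Set} {L : Fm I → Set} {K : ℕ}
  → LocallyTabular L → V ↔ Fin K → FiniteUpTo (FrameEquivalent {V = V} L)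
LocallyTabular⇒finite {I} {V} {L} {K} tab V↔K =
  List.map (rename decode) reps , λ φ → map⁺ (Any.map (equivalent φ) (cover (rename encode φ)))
  where
    open Inverse V↔K using () renaming (to to encode; from to decode; strictlyInverseʳ to decode-encode)
    reps : List (Form I (Fin K))
    reps = proj₁ (tab K)

    cover : ∀ φ → Any (λ ψ → L (embed φ ⇔ᶠ embed ψ)) reps
    cover = proj₂ (tab K)

    equivalent : ∀ φ {ψ} → L (embed (rename encode φ) ⇔ᶠ embed ψ) → FrameEquivalent L φ (rename decode ψ)
    equivalent φ {ψ} φ⇔ψ∈L G G⊨L U y =
      ⇔.trans (⇔.sym (SatV-rename G encode (λ v w → ≡.subst (λ v′ → U v′ w ⇔ U v w)
                                                      (≡.sym (decode-encode v)) ⇔.refl) y φ))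
        (⇔.trans (⇔ᶠ∈L⇒FrameEquivalent (rename encode φ) ψ φ⇔ψ∈L G G⊨L (λ n → U (decode n)) y)
          (⇔.sym (SatV-rename G decode (λ _ _ → ⇔.refl) y ψ)))

-- Strict bound: every path from x has fewer than d steps.
BoundedDepth : {I : Set} (F : Frame I) → ℕ → W F → Set
BoundedDepth F zero    x = ⊥
BoundedDepth F (suc d) x = ∀ i x′ → R F i x x′ → BoundedDepth F d x′

◇∈⇒◇-disjunction : {a : ℕ} {V : Set} (F : Frame (Fin a)) (U : V → W F → Set) (x : W F)
  (φ : Form (Fin a) V) {i : Fin a} (is : List (Fin a)) → i ∈ is
  → SatV F U x (◇ i φ) → SatV F U x (foldr (λ j ψ → ◇ j φ ∨f ψ) ⊥f is)
◇∈⇒◇-disjunction F U x φ (_ ∷ is) (here refl) s ¬s = ⊥-elim (¬s s)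
◇∈⇒◇-disjunction F U x φ (_ ∷ is) (there i∈is) s _ = ◇∈⇒◇-disjunction F U x φ is i∈is s

□A-elim : {a : ℕ} {V : Set} (F : Frame (Fin a)) (U : V → W F → Set) (x : W F) (φ : Form (Fin a) V)
  → SatV F U x (□A φ) → ∀ i x′ → R F i x x′ → SatV F U x′ φ
□A-elim {a} F U x φ s i x′ r = SatV-stable F U x′ φ λ ¬sφ →
  s (◇∈⇒◇-disjunction F U x (¬f φ) (allFin a) (∈-allFin i) λ ¬◇¬φ → ¬◇¬φ (x′ , r , ¬sφ))

□A^⊥⇒BoundedDepth : {a : ℕ} {V : Set} (F : Frame (Fin a)) (U : V → W F → Set) (d : ℕ) (x : W F)
  → SatV F U x (□A^ d ⊥f) → BoundedDepth F d x
□A^⊥⇒BoundedDepth F U zero    x s = s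
□A^⊥⇒BoundedDepth F U (suc d) x s i x′ r =
  □A^⊥⇒BoundedDepth F U d x′ (□A-elim F U x (□A^ d ⊥f) s i x′ r)

module DepthInduction (a : ℕ) {B : Set} (L₂ : Fm B → Set) (L₂-tabular : LocallyTabular L₂) (k : ℕ) where

  Formᵏ : Set
  Formᵏ = Form (Fin a ⊎ B) (Fin k)

  _≈[_]_ : Formᵏ → ℕ → Formᵏ → Set₁
  φ ≈[ d ] ψ = ∀ (F : Frame (Fin a)) (G : Frame B) → G ⊨L L₂
    → ∀ (U : Fin k → W F × W G → Set) x y → BoundedDepth F d x
    → SatV (F ×F G) U (x , y) φ ⇔ SatV (F ×F G) U (x , y) ψ

  finite-depth-zero : FiniteUpTo _≈[ zero ]_
  finite-depth-zero = ⊥f ∷ [] , λ φ → here λ F G G⊨L₂ U x y ()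

  finite-depth-suc : ∀ d → FiniteUpTo _≈[ d ]_ → FiniteUpTo _≈[ suc d ]_
  finite-depth-suc d (reps , cover) =
    List.map expand (proj₁ B-classes) ,
    λ φ → map⁺ (Any.map (expand-equivalent φ) (proj₂ B-classes (flatten φ)))
    where
      N : ℕ
      N = length reps

      Fresh : Set
      Fresh = Fin k ⊎ (Fin a × Fin N)

      flatten : Formᵏ → Form B Fresh
      flatten (var v)        = var (inj₁ v)
      flatten ⊥f             = ⊥f
      flatten (φ ⇒ ψ)        = flatten φ ⇒ flatten ψ
      flatten (◇ (inj₁ i) ψ) = var (inj₂ (i , index (cover ψ)))
      flatten (◇ (inj₂ j) ψ) = ◇ j (flatten ψ)

      unfresh : Fresh → Formᵏ
      unfresh = [ var , (λ (i , n) → ◇ (inj₁ i) (List.lookup reps n)) ]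

      expand : Form B Fresh → Formᵏ
      expand χ = subst unfresh (rename◇ inj₂ χ)

      B-classes : FiniteUpTo (FrameEquivalent {V = Fresh} L₂)
      B-classes = LocallyTabular⇒finite L₂-tabular
        (↔-trans (↔-refl ⊎-↔ ↔-sym *↔×) (↔-sym +↔⊎))

      module _ (F : Frame (Fin a)) (G : Frame B) (G⊨L₂ : G ⊨L L₂) (U : Fin k → W F × W G → Set) where

        SatV-expand : ∀ x y χ → SatV (F ×F G) U (x , y) (expand χ)
          ⇔ SatV G (λ v y′ → SatV (F ×F G) U (x , y′) (unfresh v)) y χ
        SatV-expand x y χ = ⇔.trans (SatV-subst (F ×F G) U unfresh (x , y) (rename◇ inj₂ χ))
                                    (SatV-×F-fibre F G _ x y χ)

        expand-flatten : ∀ x y → BoundedDepth F (suc d) x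
          → ∀ φ → SatV (F ×F G) U (x , y) φ ⇔ SatV (F ×F G) U (x , y) (expand (flatten φ))
        expand-flatten x y x<d+1 (var v)        = ⇔.refl
        expand-flatten x y x<d+1 ⊥f             = ⇔.refl
        expand-flatten x y x<d+1 (φ ⇒ ψ)        =
          →-cong-⇔ (expand-flatten x y x<d+1 φ) (expand-flatten x y x<d+1 ψ)
        expand-flatten x y x<d+1 (◇ (inj₁ i) ψ) = mk⇔
          (¬¬-map λ { ((x′ , y) , (r , refl) , s) →
            (x′ , y) , (r , refl) , to (lookup-result (cover ψ) F G G⊨L₂ U x′ y (x<d+1 i x′ r)) s })
          (¬¬-map λ { ((x′ , y) , (r , refl) , s) →
            (x′ , y) , (r , refl) , from (lookup-result (cover ψ) F G G⊨L₂ U x′ y (x<d+1 i x′ r)) s })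
        expand-flatten x y x<d+1 (◇ (inj₂ j) ψ) = mk⇔
          (¬¬-map λ { ((x , y′) , (refl , r) , s) →
            (x , y′) , (refl , r) , to (expand-flatten x y′ x<d+1 ψ) s })
          (¬¬-map λ { ((x , y′) , (refl , r) , s) →
            (x , y′) , (refl , r) , from (expand-flatten x y′ x<d+1 ψ) s })

      expand-equivalent : ∀ φ {χ} → FrameEquivalent L₂ (flatten φ) χ → φ ≈[ suc d ] expand χ
      expand-equivalent φ {χ} φ≈χ F G G⊨L₂ U x y x<d+1 =
        ⇔.trans (expand-flatten F G G⊨L₂ U x y x<d+1 φ)
          (⇔.trans (SatV-expand F G G⊨L₂ U x y (flatten φ))
            (⇔.trans (φ≈χ G G⊨L₂ _ y)
              (⇔.sym (SatV-expand F G G⊨L₂ U x y χ))))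

  finite-depth : ∀ d → FiniteUpTo _≈[ d ]_
  finite-depth zero    = finite-depth-zero
  finite-depth (suc d) = finite-depth-suc d (finite-depth d)

corollary4p3 : (a b : ℕ) (L₁ : Fm (Fin a) → Set) (L₂ : Fm (Fin b) → Set)
    → IsNormalLogic L₁ → IsNormalLogic L₂
    → ∃ (λ m → L₁ (□A^ m ⊥f))
    → LocallyTabular L₂
    → LocallyTabular (L₁ ⊗ L₂)
corollary4p3 a b L₁ L₂ _ _ (m , □ᵐ⊥∈L₁) L₂-tabular k = FiniteUpTo-map valid (finite-depth m)
  where
    open DepthInduction a L₂ L₂-tabular k

    valid : ∀ {φ ψ} → φ ≈[ m ] ψ → (L₁ ⊗ L₂) (embed φ ⇔ᶠ embed ψ)
    valid {φ} {ψ} φ≈ψ F G F⊨L₁ G⊨L₂ Val (x , y) =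
      from (Sat⇔SatV (F ×F G) Val (x , y) (embed φ ⇔ᶠ embed ψ))
        (SatV-⇔ᶠ-intro (F ×F G) Val (x , y) (embed φ) (embed ψ)
          (⇔.trans (SatV-rename (F ×F G) toℕ (λ _ _ → ⇔.refl) (x , y) φ)
            (⇔.trans (φ≈ψ F G G⊨L₂ _ x y x<m)
              (⇔.sym (SatV-rename (F ×F G) toℕ (λ _ _ → ⇔.refl) (x , y) ψ)))))
      where
        x<m : BoundedDepth F m x
        x<m = □A^⊥⇒BoundedDepth F (λ _ _ → ⊥) m x
                (to (Sat⇔SatV F (λ _ _ → ⊥) x (□A^ m ⊥f)) (F⊨L₁ _ □ᵐ⊥∈L₁ (λ _ _ → ⊥) x))
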